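{- Let the notions of d-frame, nd-frame, the operations $\neg$ and $\supset$, and validity be as in the context. Then: (i) For every injective frame homomorphism $m\colon L\to M$ between frames, the tuple $(L, M, \mathsf{con}_m, \mathsf{tot}_m, p_m, m)$ is an nd-frame in which the formula $\varphi\supset\neg\neg\varphi$ is valid, where $\mathsf{con}_m(a,b)\iff m(a)\land b=0$, $\mathsf{tot}_m(a,b)\iff m(a)\lor b=1$, and $p_m\colon M\to L$ is the right adjoint of $m$, i.e. $p_m(b)=\bigvee\{a\in L: m(a)\le b\}$. (ii) Conversely, if $(L_+,L_-,\mathsf{con},\mathsf{tot},p,m)$ is an nd-frame in which $\varphi\supset\neg\neg\varphi$ is valid, then $m\colon L_+\to L_-$ is an injective frame homomorphism and $\mathsf{con}=\mathsf{con}_m$, $\mathsf{tot}=\mathsf{tot}_m$, $p=p_m$. Consequently these constructions give a one-to-one correspondence between injective frame homomorphisms and nd-frames satisfying $\varphi\supset\neg\neg\varphi$.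
   Context: A frame is a complete lattice in which $(\bigvee A)\land b=\bigvee_{a\in A}(a\land b)$ for all subsets $A$ and elements $b$; a frame homomorphism preserves finite meets and arbitrary joins. For frames $L_+,L_-$, the twist-structure $L_+\bowtie L_-$ is the set $L_+\times L_-$ with the information order $(a_+,a_-)\sqsubseteq(b_+,b_-)$ iff $a_+\le b_+$ and $a_-\le b_-$ (directed joins computed componentwise), logical operations $(a_+,a_-)\mathbin{\dot\wedge}(b_+,b_-)=(a_+\land b_+,a_-\lor b_-)$, $(a_+,a_-)\mathbin{\dot\vee}(b_+,b_-)=(a_+\lor b_+,a_-\land b_-)$, and constants $\mathsf f=(0,1)$, $\mathsf t=(1,0)$. A d-frame is a tuple $(L_+,L_-,\mathsf{con},\mathsf{tot})$ with $L_+,L_-$ frames and $\mathsf{con},\mathsf{tot}\subseteq L_+\times L_-$ such that: (1) $\mathsf{con}$ and $\mathsf{tot}$ contain $\mathsf f,\mathsf t$ and are closed under $\dot\wedge,\dot\vee$; (2) $\mathsf{con}$ is downward closed and $\mathsf{tot}$ is upward closed in $\sqsubseteq$; (3) $\mathsf{con}$ is closed under directed joins in $\sqsubseteq$; (4) $\mathsf{con}(a,b)$ and $\mathsf{tot}(a,c)$ imply $b\le c$, and $\mathsf{con}(a,b)$ and $\mathsf{tot}(c,b)$ imply $a\le c$. An nd-frame $(L_+,L_-,\mathsf{con},\mathsf{tot},p,m)$ is a d-frame with maps $p\colon L_-\to L_+$, $m\colon L_+\to L_-$ such that: (1) $p,m$ preserve binary meets; (2) $p(1)=1$, $m(1)=1$;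 (3) $p(0)=0$, $m(0)=0$; (4) $p(m(a))\le a$ for $a\in L_+$ and $m(p(a))\le a$ for $a\in L_-$; (5) for $a,b\in L_+$, $c\in L_-$: $(a\land b,c)\in\mathsf{con}$ implies $(a,m(b)\land c)\in\mathsf{con}$; for $a\in L_+$, $b,c\in L_-$: $(a,b\land c)\in\mathsf{con}$ implies $(a\land p(b),c)\in\mathsf{con}$; (6) for $a,b\in L_+$, $c\in L_-$: $(a,m(b)\lor c)\in\mathsf{tot}$ implies $(a\lor b,c)\in\mathsf{tot}$; for $a\in L_+$, $b,c\in L_-$: $(a\lor p(b),c)\in\mathsf{tot}$ implies $(a,b\lor c)\in\mathsf{tot}$. In an nd-frame, for $x=(x_+,x_-),y=(y_+,y_-)\in L_+\times L_-$ define $\neg x=(p(x_-),m(x_+))$ and $x\supset y=(x_+\to y_+,\ m(x_+)\land y_-)$, where $\to$ is the Heyting implication of the frame $L_+$. A formula $\varphi$ built from variables with these operations is valid in the nd-frame if for every assignment $v$ of elements of $L_+\times L_-$ to the variables, $\mathsf t\sqsubseteq v(\varphi)$. -}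

module Defs where

open import Level using (Level; suc; _⊔_)
open import Data.Product using (uncurry; Σ; ∃; ∃-syntax; _×_; _,_; proj₁; proj₂)
open import Data.Sum using (_⊎_)
open import Data.Empty.Polymorphic using (⊥)
open import Data.Unit.Polymorphic using (⊤)
open import Relation.Binary.PropositionalEquality using (_≡_)
open import Function.Definitions using (Injective)

-- Frames: complete lattices (antisymmetric w.r.t. ≡) satisfying the
-- infinite distributive law.  Subsets are predicates  Carrier → Set o.

record Frame (o : Level) : Set (suc o) where
  infix  4 _≤_
  infixr 7 _∧_
  field
    Carrier : Set o
    _≤_     : Carrier → Carrier → Set o
    ≤-refl  : ∀ {a} → a ≤ a
    ≤-trans : ∀ {a b c} → a ≤ b → b ≤ c → a ≤ c
    ≤-antisym : ∀ {a b} → a ≤ b → b ≤ a → a ≡ b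
    ⋁       : (Carrier → Set o) → Carrier
    ⋁-upper : ∀ (A : Carrier → Set o) a → A a → a ≤ ⋁ A
    ⋁-least : ∀ (A : Carrier → Set o) b → (∀ a → A a → a ≤ b) → ⋁ A ≤ b
    _∧_     : Carrier → Carrier → Carrier
    ∧-lower₁ : ∀ a b → a ∧ b ≤ a
    ∧-lower₂ : ∀ a b → a ∧ b ≤ b
    ∧-greatest : ∀ a b c → c ≤ a → c ≤ b → c ≤ a ∧ b
    distrib : ∀ (A : Carrier → Set o) b →
              (⋁ A) ∧ b ≡ ⋁ (λ x → ∃[ a ] (A a × x ≡ a ∧ b))

  infixr 6 _∨_
  _∨_ : Carrier → Carrier → Carrier
  a ∨ b = ⋁ (λ x → x ≡ a ⊎ x ≡ b)

  𝟘 : Carrier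
  𝟘 = ⋁ (λ _ → ⊥)

  𝟙 : Carrier
  𝟙 = ⋁ (λ _ → ⊤)

  infixr 5 _⇒_
  _⇒_ : Carrier → Carrier → Carrier
  a ⇒ b = ⋁ (λ c → c ∧ a ≤ b)

open Frame public using (Carrier)

record IsFrameHom {o} (L M : Frame o) (f : Carrier L → Carrier M) : Set (suc o) where
  private
    module L = Frame L
    module M = Frame M
  field
    pres-∧ : ∀ a b → f (a L.∧ b) ≡ f a M.∧ f b
    pres-𝟙 : f L.𝟙 ≡ M.𝟙
    pres-⋁ : ∀ (A : Carrier L → Set o) →
             f (L.⋁ A) ≡ M.⋁ (λ y → ∃[ a ] (A a × y ≡ f a))

module Twist {o} (L₊ L₋ : Frame o) where
  private
    module P = Frame L₊
    module N = Frame L₋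

  T : Set o
  T = Carrier L₊ × Carrier L₋

  infix 4 _⊑_
  _⊑_ : T → T → Set o
  (a₊ , a₋) ⊑ (b₊ , b₋) = (a₊ P.≤ b₊) × (a₋ N.≤ b₋)

  _∧̇_ : T → T → T
  (a₊ , a₋) ∧̇ (b₊ , b₋) = (a₊ P.∧ b₊ , a₋ N.∨ b₋)

  _∨̇_ : T → T → T
  (a₊ , a₋) ∨̇ (b₊ , b₋) = (a₊ P.∨ b₊ , a₋ N.∧ b₋)

  𝕗 : T
  𝕗 = (P.𝟘 , N.𝟙)

  𝕥 : T
  𝕥 = (P.𝟙 , N.𝟘)

  Directed : (T → Set o) → Set o
  Directed D = (∃[ x ] D x) ×
               (∀ x y → D x → D y → ∃[ z ] (D z × x ⊑ z × y ⊑ z))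

  ⨆ : (T → Set o) → T
  ⨆ D = ( P.⋁ (λ a → ∃[ b ] D (a , b)) , N.⋁ (λ b → ∃[ a ] D (a , b)) )

record IsDFrame {o} (L₊ L₋ : Frame o)
                (con tot : Carrier L₊ → Carrier L₋ → Set o) : Set (suc o) where
  open Twist L₊ L₋
  private
    module P = Frame L₊
    module N = Frame L₋
  field
    con-𝕗 : uncurry con 𝕗
    con-𝕥 : uncurry con 𝕥
    tot-𝕗 : uncurry tot 𝕗
    tot-𝕥 : uncurry tot 𝕥
    con-∧̇ : ∀ x y → uncurry con x → uncurry con y → uncurry con (x ∧̇ y)
    con-∨̇ : ∀ x y → uncurry con x → uncurry con y → uncurry con (x ∨̇ y)
    tot-∧̇ : ∀ x y → uncurry tot x → uncurry tot y → uncurry tot (x ∧̇ y)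
    tot-∨̇ : ∀ x y → uncurry tot x → uncurry tot y → uncurry tot (x ∨̇ y)
    con-down : ∀ x y → x ⊑ y → uncurry con y → uncurry con x
    tot-up   : ∀ x y → x ⊑ y → uncurry tot x → uncurry tot y
    con-directed : ∀ (D : T → Set o) → Directed D → (∀ x → D x → uncurry con x) → uncurry con (⨆ D)
    -- (4)
    con-tot₁ : ∀ a b c → con a b → tot a c → b N.≤ c
    con-tot₂ : ∀ a b c → con a b → tot c b → a P.≤ c

record IsNDFrame {o} (L₊ L₋ : Frame o)
                 (con tot : Carrier L₊ → Carrier L₋ → Set o)
                 (p : Carrier L₋ → Carrier L₊)
                 (m : Carrier L₊ → Carrier L₋) : Set (suc o) where
  private
    module P = Frame L₊
    module N = Frame L₋
  field
    isDFrame : IsDFrame L₊ L₋ con tot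
    p-∧ : ∀ a b → p (a N.∧ b) ≡ p a P.∧ p b
    m-∧ : ∀ a b → m (a P.∧ b) ≡ m a N.∧ m b
    p-𝟙 : p N.𝟙 ≡ P.𝟙
    m-𝟙 : m P.𝟙 ≡ N.𝟙
    p-𝟘 : p N.𝟘 ≡ P.𝟘
    m-𝟘 : m P.𝟘 ≡ N.𝟘
    pm≤ : ∀ a → p (m a) P.≤ a
    mp≤ : ∀ a → m (p a) N.≤ a
    -- (5)
    con-m : ∀ a b c → con (a P.∧ b) c → con a (m b N.∧ c)
    con-p : ∀ a b c → con a (b N.∧ c) → con (a P.∧ p b) c
    -- (6)
    tot-m : ∀ a b c → tot a (m b N.∨ c) → tot (a P.∨ b) c
    tot-p : ∀ a b c → tot (a P.∨ p b) c → tot a (b N.∨ c)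

module NDOps {o} (L₊ L₋ : Frame o)
             (p : Carrier L₋ → Carrier L₊) (m : Carrier L₊ → Carrier L₋) where
  open Twist L₊ L₋
  private
    module P = Frame L₊
    module N = Frame L₋

  ¬̇ : T → T
  ¬̇ (x₊ , x₋) = (p x₋ , m x₊)

  _⊃_ : T → T → T
  (x₊ , x₋) ⊃ (y₊ , y₋) = (x₊ P.⇒ y₊ , m x₊ N.∧ y₋)

  -- validity of the formula  φ ⊃ ¬¬φ  (φ a variable): for every
  -- assignment x of φ,  𝕥 ⊑ x ⊃ ¬¬x
  Valid-⊃¬¬ : Set o
  Valid-⊃¬¬ = ∀ (x : T) → 𝕥 ⊑ (x ⊃ ¬̇ (¬̇ x))

module Induced {o} (L M : Frame o) (m : Carrier L → Carrier M) where
  private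
    module L = Frame L
    module M = Frame M

  con-m : Carrier L → Carrier M → Set o
  con-m a b = m a M.∧ b ≡ M.𝟘

  tot-m : Carrier L → Carrier M → Set o
  tot-m a b = m a M.∨ b ≡ M.𝟙

  -- right adjoint  p_m(b) = ⋁ { a | m a ≤ b }
  p-m : Carrier M → Carrier L
  p-m b = L.⋁ (λ a → m a M.≤ b)

module Submission where

-- Validity of φ ⊃ ¬¬φ says exactly that a ≤ p (m a) for every a.  Together with the
-- nd-frame axioms p (m a) ≤ a and m (p b) ≤ b this makes m left adjoint to p with
-- p ∘ m = id, so m is an injective frame homomorphism and p is its right adjoint p_m;
-- instantiating the interaction axioms (5), (6) at 𝟙 and 𝟘 and using axiom (4) of
-- d-frames then forces con = con_m and tot = tot_m.  Conversely, for an injective frame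
-- homomorphism m the d-frame axioms of con_m and tot_m are distributive-lattice facts
-- about disjoint (x ∧ y = 𝟘) and covering (x ∨ y = 𝟙) pairs, and the nd-frame axioms
-- come from the adjunction m ⊣ p_m, injectivity giving p_m ∘ m ≤ id.

open import Defs
open import Level using (Level)
open import Data.Product using (Σ; _×_; _,_; proj₁; ∃-syntax; uncurry)
open import Data.Sum using (inj₁; inj₂)
open import Data.Unit.Polymorphic using (tt)
open import Function.Bundles using (_⇔_; mk⇔; Equivalence)
open import Function.Definitions using (Injective)
open import Relation.Binary.Lattice using (HeytingAlgebra)
open import Relation.Binary.PropositionalEquality
  using (_≡_; refl; sym; trans; cong; cong₂; subst; isEquivalence; module ≡-Reasoning)
import Relation.Binary.Reasoning.PartialOrder as PosetReasoning
import Relation.Binary.Lattice.Properties.HeytingAlgebra as HeytingAlgebraProperties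
import Relation.Binary.Lattice.Properties.DistributiveLattice as DistributiveLatticeProperties
import Relation.Binary.Lattice.Properties.MeetSemilattice as MeetSemilatticeProperties
import Relation.Binary.Lattice.Properties.JoinSemilattice as JoinSemilatticeProperties
import Relation.Binary.Lattice.Properties.BoundedMeetSemilattice as BoundedMeetSemilatticeProperties

module FrameProperties {o} (F : Frame o) where
  open Frame F public
    using (_≤_; ≤-refl; ≤-trans; ≤-antisym; ⋁; ⋁-upper; ⋁-least; _∧_; _∨_; 𝟘; 𝟙; _⇒_)
  open Frame F using (∧-lower₁; ∧-lower₂; distrib)

  ⋁∧-least : ∀ (A : Carrier F → Set o) b c → (∀ a → A a → a ∧ b ≤ c) → ⋁ A ∧ b ≤ c
  ⋁∧-least A b c h = subst (_≤ c) (sym (distrib A b)) (⋁-least _ c bound)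
    where
      bound : ∀ x → ∃[ a ] (A a × x ≡ a ∧ b) → x ≤ c
      bound _ (a , Aa , refl) = h a Aa

  heytingAlgebra : HeytingAlgebra o o o
  heytingAlgebra = record
    { _≈_ = _≡_ ; _≤_ = _≤_ ; _∨_ = _∨_ ; _∧_ = _∧_ ; _⇨_ = _⇒_ ; ⊤ = 𝟙 ; ⊥ = 𝟘
    ; isHeytingAlgebra = record
      { isBoundedLattice = record
        { isLattice = record
          { isPartialOrder = record
            { isPreorder = record
              { isEquivalence = isEquivalence
              ; reflexive = λ { refl → ≤-refl }
              ; trans = ≤-trans
              }
            ; antisym = ≤-antisym
            }
          ; supremum = λ a b → ⋁-upper _ a (inj₁ refl) , ⋁-upper _ b (inj₂ refl) , ∨-least
          ; infimum = λ a b → ∧-lower₁ a b , ∧-lower₂ a b , λ c → Frame.∧-greatest F a b c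
          }
        ; maximum = λ a → ⋁-upper _ a tt
        ; minimum = λ a → ⋁-least _ a (λ _ ())
        }
      ; exponential = λ w a b →
          ⋁-upper _ w , λ w≤a⇒b → ≤-trans (∧-monotone w≤a⇒b ≤-refl) (⋁∧-least _ a b (λ _ h → h))
      }
    }
    where
      ∨-least : ∀ {a b} c → a ≤ c → b ≤ c → a ∨ b ≤ c
      ∨-least {a} {b} c a≤c b≤c = ⋁-least _ c λ { _ (inj₁ refl) → a≤c ; _ (inj₂ refl) → b≤c }
      ∧-monotone : ∀ {a b c d} → a ≤ b → c ≤ d → a ∧ c ≤ b ∧ d
      ∧-monotone {a} {b} {c} {d} a≤b c≤d = Frame.∧-greatest F b d _
        (≤-trans (∧-lower₁ a c) a≤b) (≤-trans (∧-lower₂ a c) c≤d)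

  open HeytingAlgebra heytingAlgebra public
    using (poset; reflexive; x≤x∨y; y≤x∨y; ∨-least; x∧y≤x; x∧y≤y; ∧-greatest; maximum; minimum;
           transpose-⇨; transpose-∧)
  open HeytingAlgebraProperties heytingAlgebra public
    using (∧-distribˡ-∨; distributiveLattice)
  open MeetSemilatticeProperties (HeytingAlgebra.meetSemilattice heytingAlgebra) public
    using (∧-comm; ∧-assoc; ∧-monotonic)
  open DistributiveLatticeProperties distributiveLattice public using (∧-distribʳ-∨)
  open JoinSemilatticeProperties (HeytingAlgebra.joinSemilattice heytingAlgebra) public
    using (∨-comm; ∨-assoc; ∨-monotonic)
  open BoundedMeetSemilatticeProperties (HeytingAlgebra.boundedMeetSemilattice heytingAlgebra) public
    using (identityˡ)

  module ≤-Reasoning = PosetReasoning poset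

  ≤𝟘⇒≡𝟘 : ∀ {a} → a ≤ 𝟘 → a ≡ 𝟘
  ≤𝟘⇒≡𝟘 a≤𝟘 = ≤-antisym a≤𝟘 (minimum _)

  𝟙≤⇒≡𝟙 : ∀ {a} → 𝟙 ≤ a → a ≡ 𝟙
  𝟙≤⇒≡𝟙 𝟙≤a = ≤-antisym (maximum _) 𝟙≤a

  𝟙≤⇒⇔≤ : ∀ {a b} → 𝟙 ≤ a ⇒ b ⇔ a ≤ b
  𝟙≤⇒⇔≤ {a} {b} = mk⇔
    (λ 𝟙≤a⇒b → subst (_≤ b) (identityˡ a) (transpose-∧ {𝟙} {a} {b} 𝟙≤a⇒b))
    (λ a≤b → transpose-⇨ {𝟙} {a} {b} (≤-trans (x∧y≤y 𝟙 a) a≤b))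

  disjoint-mono : ∀ {x x′ y y′} → x′ ≤ x → y′ ≤ y → x ∧ y ≡ 𝟘 → x′ ∧ y′ ≡ 𝟘
  disjoint-mono {x} {x′} {y} {y′} x′≤x y′≤y x∧y≡𝟘 = ≤𝟘⇒≡𝟘 (begin
    x′ ∧ y′  ≤⟨ ∧-monotonic x′≤x y′≤y ⟩
    x ∧ y    ≡⟨ x∧y≡𝟘 ⟩
    𝟘        ∎)
    where open ≤-Reasoning

  covering-mono : ∀ {x x′ y y′} → x ≤ x′ → y ≤ y′ → x ∨ y ≡ 𝟙 → x′ ∨ y′ ≡ 𝟙
  covering-mono {x} {x′} {y} {y′} x≤x′ y≤y′ x∨y≡𝟙 = 𝟙≤⇒≡𝟙 (begin
    𝟙        ≡⟨ sym x∨y≡𝟙 ⟩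
    x ∨ y    ≤⟨ ∨-monotonic x≤x′ y≤y′ ⟩
    x′ ∨ y′  ∎)
    where open ≤-Reasoning

  disjoint-sym : ∀ {x y} → x ∧ y ≡ 𝟘 → y ∧ x ≡ 𝟘
  disjoint-sym {x} {y} = trans (∧-comm y x)

  covering-sym : ∀ {x y} → x ∨ y ≡ 𝟙 → y ∨ x ≡ 𝟙
  covering-sym {x} {y} = trans (∨-comm y x)

  disjoint-∧-∨ : ∀ {x₁ x₂ y₁ y₂} → x₁ ∧ y₁ ≡ 𝟘 → x₂ ∧ y₂ ≡ 𝟘 → (x₁ ∧ x₂) ∧ (y₁ ∨ y₂) ≡ 𝟘
  disjoint-∧-∨ {x₁} {x₂} {y₁} {y₂} x₁∧y₁≡𝟘 x₂∧y₂≡𝟘 = ≤𝟘⇒≡𝟘 (begin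
    (x₁ ∧ x₂) ∧ (y₁ ∨ y₂)              ≡⟨ ∧-distribˡ-∨ _ y₁ y₂ ⟩
    (x₁ ∧ x₂) ∧ y₁ ∨ (x₁ ∧ x₂) ∧ y₂    ≤⟨ ∨-monotonic (∧-monotonic (x∧y≤x x₁ x₂) ≤-refl)
                                                     (∧-monotonic (x∧y≤y x₁ x₂) ≤-refl) ⟩
    x₁ ∧ y₁ ∨ x₂ ∧ y₂                  ≡⟨ cong₂ _∨_ x₁∧y₁≡𝟘 x₂∧y₂≡𝟘 ⟩
    𝟘 ∨ 𝟘                              ≤⟨ ∨-least ≤-refl ≤-refl ⟩
    𝟘                                  ∎)
    where open ≤-Reasoning

  covering-∧-∨ : ∀ {x₁ x₂ y₁ y₂} → x₁ ∨ y₁ ≡ 𝟙 → x₂ ∨ y₂ ≡ 𝟙 → (x₁ ∧ x₂) ∨ (y₁ ∨ y₂) ≡ 𝟙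
  covering-∧-∨ {x₁} {x₂} {y₁} {y₂} x₁∨y₁≡𝟙 x₂∨y₂≡𝟙 = 𝟙≤⇒≡𝟙 (begin
    𝟙                                  ≤⟨ ∧-greatest ≤-refl ≤-refl ⟩
    𝟙 ∧ 𝟙                              ≡⟨ sym (cong₂ _∧_ x₁∨y₁≡𝟙 x₂∨y₂≡𝟙) ⟩
    (x₁ ∨ y₁) ∧ (x₂ ∨ y₂)              ≡⟨ ∧-distribˡ-∨ _ x₂ y₂ ⟩
    (x₁ ∨ y₁) ∧ x₂ ∨ (x₁ ∨ y₁) ∧ y₂    ≡⟨ cong (_∨ (x₁ ∨ y₁) ∧ y₂) (∧-distribʳ-∨ x₂ x₁ y₁) ⟩
    (x₁ ∧ x₂ ∨ y₁ ∧ x₂) ∨ (x₁ ∨ y₁) ∧ y₂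
      ≤⟨ ∨-monotonic (∨-monotonic ≤-refl (x∧y≤x y₁ x₂)) (x∧y≤y _ y₂) ⟩
    (x₁ ∧ x₂ ∨ y₁) ∨ y₂                ≡⟨ ∨-assoc _ y₁ y₂ ⟩
    x₁ ∧ x₂ ∨ (y₁ ∨ y₂)                ∎)
    where open ≤-Reasoning

  disjoint∧covering⇒≤ : ∀ {x y z} → x ∧ y ≡ 𝟘 → x ∨ z ≡ 𝟙 → y ≤ z
  disjoint∧covering⇒≤ {x} {y} {z} x∧y≡𝟘 x∨z≡𝟙 = begin
    y                  ≤⟨ ∧-greatest ≤-refl (maximum y) ⟩
    y ∧ 𝟙              ≡⟨ cong (y ∧_) (sym x∨z≡𝟙) ⟩
    y ∧ (x ∨ z)        ≡⟨ ∧-distribˡ-∨ y x z ⟩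
    y ∧ x ∨ y ∧ z      ≡⟨ cong (_∨ y ∧ z) (trans (∧-comm y x) x∧y≡𝟘) ⟩
    𝟘 ∨ y ∧ z          ≤⟨ ∨-least (minimum z) (x∧y≤y y z) ⟩
    z                  ∎
    where open ≤-Reasoning

  ⋁-disjoint : ∀ (A B : Carrier F → Set o) →
               (∀ a b → A a → B b → a ∧ b ≡ 𝟘) → ⋁ A ∧ ⋁ B ≡ 𝟘
  ⋁-disjoint A B disjoint = ≤𝟘⇒≡𝟘 (⋁∧-least A (⋁ B) 𝟘 λ a Aa → begin
    a ∧ ⋁ B   ≡⟨ ∧-comm a (⋁ B) ⟩
    ⋁ B ∧ a   ≤⟨ ⋁∧-least B a 𝟘 (λ b Bb → reflexive (disjoint-sym (disjoint a b Aa Bb))) ⟩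
    𝟘         ∎)
    where open ≤-Reasoning

module _ {o} (L M : Frame o) (f : Carrier L → Carrier M) where
  private
    module L = FrameProperties L
    module M = FrameProperties M

  ∧-preserving⇒monotone : (∀ a b → f (a L.∧ b) ≡ f a M.∧ f b) →
                          ∀ {a b} → a L.≤ b → f a M.≤ f b
  ∧-preserving⇒monotone f-∧ {a} {b} a≤b = begin
    f a          ≡⟨ cong f (L.≤-antisym (L.∧-greatest L.≤-refl a≤b) (L.x∧y≤x a b)) ⟩
    f (a L.∧ b)  ≡⟨ f-∧ a b ⟩
    f a M.∧ f b  ≤⟨ M.x∧y≤y (f a) (f b) ⟩
    f b          ∎
    where open M.≤-Reasoning

  ∧-preserving∧injective⇒≤-reflecting : (∀ a b → f (a L.∧ b) ≡ f a M.∧ f b) →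
                                         Injective _≡_ _≡_ f →
                                         ∀ {a b} → f a M.≤ f b → a L.≤ b
  ∧-preserving∧injective⇒≤-reflecting f-∧ injective {a} {b} fa≤fb = begin
    a        ≡⟨ injective fa≡f[a∧b] ⟩
    a L.∧ b  ≤⟨ L.x∧y≤y a b ⟩
    b        ∎
    where
      open L.≤-Reasoning
      fa≡f[a∧b] : f a ≡ f (a L.∧ b)
      fa≡f[a∧b] = trans (M.≤-antisym (M.∧-greatest M.≤-refl fa≤fb) (M.x∧y≤x (f a) (f b)))
                        (sym (f-∧ a b))

module Adjunction {o} (L M : Frame o)
                  (f : Carrier L → Carrier M) (g : Carrier M → Carrier L)
                  (f⊣g : ∀ {a b} → Frame._≤_ M (f a) b ⇔ Frame._≤_ L a (g b)) where
  private
    module L = FrameProperties L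
    module M = FrameProperties M
  open Equivalence

  unit : ∀ a → a L.≤ g (f a)
  unit a = to f⊣g M.≤-refl

  counit : ∀ b → f (g b) M.≤ b
  counit b = from f⊣g L.≤-refl

  f-monotone : ∀ {a a′} → a L.≤ a′ → f a M.≤ f a′
  f-monotone {a′ = a′} a≤a′ = from f⊣g (L.≤-trans a≤a′ (unit a′))

  g-monotone : ∀ {b b′} → b M.≤ b′ → g b L.≤ g b′
  g-monotone {b} b≤b′ = to f⊣g (M.≤-trans (counit b) b≤b′)

  f-⋁ : ∀ (A : Carrier L → Set o) → f (L.⋁ A) ≡ M.⋁ (λ y → ∃[ a ] (A a × y ≡ f a))
  f-⋁ A = M.≤-antisym
    (from f⊣g (L.⋁-least A _ λ a Aa → to f⊣g (M.⋁-upper _ (f a) (a , Aa , refl))))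
    (M.⋁-least _ _ λ { _ (a , Aa , refl) → f-monotone (L.⋁-upper A a Aa) })

  g-∧ : ∀ b c → g (b M.∧ c) ≡ g b L.∧ g c
  g-∧ b c = L.≤-antisym
    (L.∧-greatest (g-monotone (M.x∧y≤x b c)) (g-monotone (M.x∧y≤y b c)))
    (to f⊣g (M.∧-greatest
      (M.≤-trans (f-monotone (L.x∧y≤x (g b) (g c))) (counit b))
      (M.≤-trans (f-monotone (L.x∧y≤y (g b) (g c))) (counit c))))

  g-𝟙 : g M.𝟙 ≡ L.𝟙
  g-𝟙 = L.≤-antisym (L.maximum _) (to f⊣g (M.maximum _))

  g≡⋁ : ∀ b → g b ≡ L.⋁ (λ a → f a M.≤ b)
  g≡⋁ b = L.≤-antisym (L.⋁-upper _ (g b) (counit b)) (L.⋁-least _ (g b) λ _ → to f⊣g)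

module FrameHomProperties {o} {L M : Frame o} {m : Carrier L → Carrier M}
                          (hom : IsFrameHom L M m) where
  private
    module L = FrameProperties L
    module M = FrameProperties M
  open IsFrameHom hom
  open Induced L M m using (p-m)

  monotone : ∀ {a b} → a L.≤ b → m a M.≤ m b
  monotone = ∧-preserving⇒monotone L M m pres-∧

  map-⋁-least : ∀ (A : Carrier L → Set o) c → (∀ a → A a → m a M.≤ c) → m (L.⋁ A) M.≤ c
  map-⋁-least A c bound = begin
    m (L.⋁ A)                             ≡⟨ pres-⋁ A ⟩
    M.⋁ (λ y → ∃[ a ] (A a × y ≡ m a))   ≤⟨ M.⋁-least _ c (λ { _ (a , Aa , refl) → bound a Aa }) ⟩
    c                                     ∎
    where open M.≤-Reasoning

  map-𝟘 : m L.𝟘 ≡ M.𝟘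
  map-𝟘 = M.≤𝟘⇒≡𝟘 (map-⋁-least _ M.𝟘 λ _ ())

  map-∨ : ∀ a b → m (a L.∨ b) ≡ m a M.∨ m b
  map-∨ a b = M.≤-antisym
    (map-⋁-least _ _ λ { _ (inj₁ refl) → M.x≤x∨y (m a) (m b) ; _ (inj₂ refl) → M.y≤x∨y (m a) (m b) })
    (M.∨-least (monotone (L.x≤x∨y a b)) (monotone (L.y≤x∨y a b)))

  m⊣p-m : ∀ {a b} → m a M.≤ b ⇔ a L.≤ p-m b
  m⊣p-m {a} {b} = mk⇔ (L.⋁-upper _ a)
    (λ a≤p-m[b] → M.≤-trans (monotone a≤p-m[b]) (map-⋁-least _ b λ _ ma≤b → ma≤b))

module _ {o} (L₊ L₋ : Frame o) (p : Carrier L₋ → Carrier L₊) (m : Carrier L₊ → Carrier L₋) where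
  private
    module P = FrameProperties L₊
    module N = FrameProperties L₋

  Valid-⊃¬¬⇔unit : NDOps.Valid-⊃¬¬ L₊ L₋ p m ⇔ (∀ a → a P.≤ p (m a))
  Valid-⊃¬¬⇔unit = mk⇔
    (λ valid a → Equivalence.to P.𝟙≤⇒⇔≤ (proj₁ (valid (a , N.𝟘))))
    (λ { unit (a , _) → Equivalence.from P.𝟙≤⇒⇔≤ (unit a) , N.minimum _ })

module InducedNDFrame {o} {L M : Frame o} {m : Carrier L → Carrier M}
                      (hom : IsFrameHom L M m) (injective : Injective _≡_ _≡_ m) where
  private
    module L = FrameProperties L
    module M = FrameProperties M
  open IsFrameHom hom
  open FrameHomProperties hom
  open Induced L M m
  open Twist L M
  open Adjunction L M m p-m m⊣p-m

  ≤-reflecting : ∀ {a b} → m a M.≤ m b → a L.≤ b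
  ≤-reflecting = ∧-preserving∧injective⇒≤-reflecting L M m pres-∧ injective

  p-m∘m≤id : ∀ a → p-m (m a) L.≤ a
  p-m∘m≤id a = L.⋁-least _ a λ _ → ≤-reflecting

  p-m-𝟘 : p-m M.𝟘 ≡ L.𝟘
  p-m-𝟘 = L.≤𝟘⇒≡𝟘 (L.⋁-least _ L.𝟘 λ _ ma≤𝟘 → ≤-reflecting (M.≤-trans ma≤𝟘 (M.reflexive (sym map-𝟘))))

  con-m-directed : ∀ (D : T → Set o) → Directed D → (∀ x → D x → uncurry con-m x) → uncurry con-m (⨆ D)
  con-m-directed D (_ , directed) con-D =
    trans (cong (M._∧ _) (pres-⋁ _)) (M.⋁-disjoint _ _ pairwise-disjoint)
    where
      pairwise-disjoint : ∀ y b → ∃[ a ] ((∃[ b₀ ] D (a , b₀)) × y ≡ m a) → ∃[ a′ ] D (a′ , b) →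
                          y M.∧ b ≡ M.𝟘
      pairwise-disjoint _ b (a , (b₀ , Dab₀) , refl) (a′ , Da′b)
        with directed (a , b₀) (a′ , b) Dab₀ Da′b
      ... | z , Dz , (a≤z₊ , _) , (_ , b≤z₋) = M.disjoint-mono (monotone a≤z₊) b≤z₋ (con-D z Dz)

  isDFrame : IsDFrame L M con-m tot-m
  isDFrame = record
    { con-𝕗 = M.≤𝟘⇒≡𝟘 (M.≤-trans (M.x∧y≤x _ _) (M.reflexive map-𝟘))
    ; con-𝕥 = M.≤𝟘⇒≡𝟘 (M.x∧y≤y _ _)
    ; tot-𝕗 = M.𝟙≤⇒≡𝟙 (M.y≤x∨y _ _)
    ; tot-𝕥 = M.𝟙≤⇒≡𝟙 (M.≤-trans (M.reflexive (sym pres-𝟙)) (M.x≤x∨y _ _))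
    ; con-∧̇ = λ { (a₁ , _) (a₂ , _) e₁ e₂ →
        M.disjoint-mono (M.reflexive (pres-∧ a₁ a₂)) M.≤-refl (M.disjoint-∧-∨ e₁ e₂) }
    ; con-∨̇ = λ { (a₁ , _) (a₂ , _) e₁ e₂ →
        M.disjoint-mono (M.reflexive (map-∨ a₁ a₂)) M.≤-refl
          (M.disjoint-sym (M.disjoint-∧-∨ (M.disjoint-sym e₁) (M.disjoint-sym e₂))) }
    ; tot-∧̇ = λ { (a₁ , _) (a₂ , _) e₁ e₂ →
        M.covering-mono (M.reflexive (sym (pres-∧ a₁ a₂))) M.≤-refl (M.covering-∧-∨ e₁ e₂) }
    ; tot-∨̇ = λ { (a₁ , _) (a₂ , _) e₁ e₂ →
        M.covering-mono (M.reflexive (sym (map-∨ a₁ a₂))) M.≤-refl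
          (M.covering-sym (M.covering-∧-∨ (M.covering-sym e₁) (M.covering-sym e₂))) }
    ; con-down = λ { _ _ (a≤c , b≤d) → M.disjoint-mono (monotone a≤c) b≤d }
    ; tot-up = λ { _ _ (a≤c , b≤d) → M.covering-mono (monotone a≤c) b≤d }
    ; con-directed = con-m-directed
    ; con-tot₁ = λ _ _ _ → M.disjoint∧covering⇒≤
    ; con-tot₂ = λ _ _ _ e₁ e₂ → ≤-reflecting (M.disjoint∧covering⇒≤ (M.disjoint-sym e₁) (M.covering-sym e₂))
    }

  isNDFrame : IsNDFrame L M con-m tot-m p-m m
  isNDFrame = record
    { isDFrame = isDFrame
    ; p-∧ = g-∧
    ; m-∧ = pres-∧
    ; p-𝟙 = g-𝟙
    ; m-𝟙 = pres-𝟙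
    ; p-𝟘 = p-m-𝟘
    ; m-𝟘 = map-𝟘
    ; pm≤ = p-m∘m≤id
    ; mp≤ = counit
    ; con-m = λ a b c e → begin
        m a M.∧ (m b M.∧ c)   ≡⟨ sym (M.∧-assoc (m a) (m b) c) ⟩
        (m a M.∧ m b) M.∧ c   ≡⟨ cong (M._∧ c) (sym (pres-∧ a b)) ⟩
        m (a L.∧ b) M.∧ c     ≡⟨ e ⟩
        M.𝟘                   ∎
    ; con-p = λ a b c e →
        M.disjoint-mono (M.≤-trans (M.reflexive (pres-∧ a (p-m b))) (M.∧-monotonic M.≤-refl (counit b)))
          M.≤-refl (trans (M.∧-assoc (m a) b c) e)
    ; tot-m = λ a b c e → trans (cong (M._∨ c) (map-∨ a b)) (trans (M.∨-assoc (m a) (m b) c) e)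
    ; tot-p = λ a b c e → trans (sym (M.∨-assoc (m a) b c))
        (M.covering-mono (M.≤-trans (M.reflexive (map-∨ a (p-m b))) (M.∨-monotonic M.≤-refl (counit b)))
          M.≤-refl e)
    }
    where open ≡-Reasoning

  valid : NDOps.Valid-⊃¬¬ L M p-m m
  valid = Equivalence.from (Valid-⊃¬¬⇔unit L M p-m m) unit

module NDFrameProperties {o} {L₊ L₋ : Frame o} {con tot : Carrier L₊ → Carrier L₋ → Set o}
                         {p : Carrier L₋ → Carrier L₊} {m : Carrier L₊ → Carrier L₋}
                         (nd : IsNDFrame L₊ L₋ con tot p m) where
  private
    module P = FrameProperties L₊
    module N = FrameProperties L₋
  open IsNDFrame nd
  open IsDFrame isDFrame

  con⇒m∧≡𝟘 : ∀ {a b} → con a b → m a N.∧ b ≡ N.𝟘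
  con⇒m∧≡𝟘 {a} {b} con-a-b = N.≤𝟘⇒≡𝟘 (con-tot₁ P.𝟙 (m a N.∧ b) N.𝟘 con-𝟙-ma∧b tot-𝕥)
    where
      con-𝟙-ma∧b : con P.𝟙 (m a N.∧ b)
      con-𝟙-ma∧b = con-m P.𝟙 a b (con-down _ _ (P.x∧y≤y P.𝟙 a , N.≤-refl) con-a-b)

  m∨≡𝟙⇒tot : ∀ {a b} → m a N.∨ b ≡ N.𝟙 → tot a b
  m∨≡𝟙⇒tot {a} {b} ma∨b≡𝟙 = tot-up _ _ (P.∨-least (P.minimum a) P.≤-refl , N.≤-refl) tot-𝟘∨a-b
    where
      tot-𝟘∨a-b : tot (P.𝟘 P.∨ a) b
      tot-𝟘∨a-b = tot-m P.𝟘 a b (tot-up _ _ (P.≤-refl , N.reflexive (sym ma∨b≡𝟙)) tot-𝕗)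

  module _ (unit : ∀ a → a P.≤ p (m a)) where

    m∧≡𝟘⇒con : ∀ {a b} → m a N.∧ b ≡ N.𝟘 → con a b
    m∧≡𝟘⇒con {a} {b} ma∧b≡𝟘 =
      con-down _ _ (P.∧-greatest (P.maximum a) (unit a) , N.≤-refl) (con-p P.𝟙 (m a) b con-𝟙-ma∧b)
      where
        con-𝟙-ma∧b : con P.𝟙 (m a N.∧ b)
        con-𝟙-ma∧b = con-down _ _ (P.≤-refl , N.reflexive ma∧b≡𝟘) con-𝕥

    tot⇒m∨≡𝟙 : ∀ {a b} → tot a b → m a N.∨ b ≡ N.𝟙
    tot⇒m∨≡𝟙 {a} {b} tot-a-b = N.𝟙≤⇒≡𝟙 (con-tot₁ P.𝟘 N.𝟙 (m a N.∨ b) con-𝕗 tot-𝟘-ma∨b)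
      where
        tot-𝟘-ma∨b : tot P.𝟘 (m a N.∨ b)
        tot-𝟘-ma∨b = tot-p P.𝟘 (m a) b
          (tot-up _ _ (P.≤-trans (unit a) (P.y≤x∨y P.𝟘 (p (m a))) , N.≤-refl) tot-a-b)

    p∘m≡id : ∀ a → p (m a) ≡ a
    p∘m≡id a = P.≤-antisym (pm≤ a) (unit a)

    m-injective : Injective _≡_ _≡_ m
    m-injective {a} {a′} ma≡ma′ = begin
      a          ≡⟨ sym (p∘m≡id a) ⟩
      p (m a)    ≡⟨ cong p ma≡ma′ ⟩
      p (m a′)   ≡⟨ p∘m≡id a′ ⟩
      a′         ∎
      where open ≡-Reasoning

    m⊣p : ∀ {a b} → m a N.≤ b ⇔ a P.≤ p b
    m⊣p {a} {b} = mk⇔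
      (λ ma≤b → P.≤-trans (unit a) (∧-preserving⇒monotone L₋ L₊ p p-∧ ma≤b))
      (λ a≤pb → N.≤-trans (∧-preserving⇒monotone L₊ L₋ m m-∧ a≤pb) (mp≤ b))

    open Adjunction L₊ L₋ m p m⊣p using (f-⋁; g≡⋁)

    m-isFrameHom : IsFrameHom L₊ L₋ m
    m-isFrameHom = record { pres-∧ = m-∧ ; pres-𝟙 = m-𝟙 ; pres-⋁ = f-⋁ }

    p≡p-m : ∀ b → p b ≡ Induced.p-m L₊ L₋ m b
    p≡p-m = g≡⋁

proposition2 : ∀ {o : Level} →
    (∀ (L M : Frame o) (m : Carrier L → Carrier M) →
       IsFrameHom L M m → Injective _≡_ _≡_ m →
       Σ (IsNDFrame L M (Induced.con-m L M m) (Induced.tot-m L M m) (Induced.p-m L M m) m)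
         (λ _ → NDOps.Valid-⊃¬¬ L M (Induced.p-m L M m) m))
    ×
    (∀ (L₊ L₋ : Frame o) (con tot : Carrier L₊ → Carrier L₋ → Set o)
       (p : Carrier L₋ → Carrier L₊) (m : Carrier L₊ → Carrier L₋) →
       IsNDFrame L₊ L₋ con tot p m → NDOps.Valid-⊃¬¬ L₊ L₋ p m →
       IsFrameHom L₊ L₋ m × Injective _≡_ _≡_ m
       × (∀ a b → con a b ⇔ Induced.con-m L₊ L₋ m a b)
       × (∀ a b → tot a b ⇔ Induced.tot-m L₊ L₋ m a b)
       × (∀ b → p b ≡ Induced.p-m L₊ L₋ m b))
proposition2 =
  (λ L M m hom injective → let open InducedNDFrame hom injective in isNDFrame , valid) ,
  (λ L₊ L₋ con tot p m nd valid →
     let open NDFrameProperties nd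
         unit = Equivalence.to (Valid-⊃¬¬⇔unit L₊ L₋ p m) valid
     in m-isFrameHom unit , m-injective unit
        , (λ a b → mk⇔ con⇒m∧≡𝟘 (m∧≡𝟘⇒con unit))
        , (λ a b → mk⇔ (tot⇒m∨≡𝟙 unit) m∨≡𝟙⇒tot)
        , p≡p-m unit)
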